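{- Let $n$ be a positive integer and set $B=\{\sigma(0,j,n):1\le j\le n-1\}$, $L=\{\sigma(0,j,k): 0<j<k\le n-1\}$ and $F=\{\sigma(i,j,n): 1\le i<j<n\}$. In the Cayley graph $\mathrm{Cay}(\mathrm{Sym}_n,T_n)$: (i) every vertex in $L\cup F$ is adjacent to exactly one vertex of $B$, while every vertex of $B$ is adjacent to exactly $n-2$ vertices of $L\cup F$; (ii) every vertex of $L$ is adjacent to exactly one vertex of $F$, and every vertex of $F$ is adjacent to exactly one vertex of $L$.
   Context: $\mathrm{Sym}_n$ is the symmetric group on $[n]$, permutations in one-line notation, $(\pi\circ\rho)(t)=\pi(\rho(t))$. For integers $0\le i<j<k\le n$ the block transposition $\sigma(i,j,k)$ is the permutation $[1\cdots i\ \ j+1\cdots k\ \ i+1\cdots j\ \ k+1\cdots n]$; $T_n$ is the set of all block transpositions. $\mathrm{Cay}(\mathrm{Sym}_n,T_n)$ has vertex set $\mathrm{Sym}_n$, with $\pi\sim\rho$ iff $\rho=\pi\circ\sigma$ for some $\sigma\in T_n$. -}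

module Defs where

open import Data.Nat using (ℕ; zero; suc; _+_; _∸_; _≤_; _<_; _<?_)
open import Data.Fin using (Fin; toℕ; fromℕ<)
open import Data.Vec using (Vec; tabulate; lookup)
open import Data.List using (List; length)
open import Data.List.Membership.Propositional using (_∈_)
open import Data.List.Relation.Unary.Unique.Propositional using (Unique)
open import Data.Product using (Σ; ∃; ∃-syntax; _×_)
open import Relation.Nullary using (yes; no)
open import Relation.Binary.PropositionalEquality using (_≡_)

-- Permutations of [n] in one-line notation, 0-based: entry at position p
-- (i.e. value at t = p+1) is stored as a Fin n (value - 1).
Word : ℕ → Set
Word n = Vec (Fin n) n

_∘ₚ_ : ∀ {n} → Word n → Word n → Word n
π ∘ₚ ρ = tabulate (λ t → lookup π (lookup ρ t))

-- 0-based value map of σ(i,j,k):  [1..i, j+1..k, i+1..j, k+1..n]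
btMap : ℕ → ℕ → ℕ → ℕ → ℕ
btMap i j k p with p <? i
... | yes _ = p
... | no _ with p <? i + (k ∸ j)
...   | yes _ = p + (j ∸ i)
...   | no _ with p <? k
...     | yes _ = p ∸ (k ∸ j)
...     | no _ = p

-- block transposition σ(i,j,k) as a word in Sym_n (the fallback branch is
-- never used when 0 ≤ i < j < k ≤ n)
σ : ∀ n → ℕ → ℕ → ℕ → Word n
σ n i j k = tabulate entry
  where
  entry : Fin n → Fin n
  entry p with btMap i j k (toℕ p) <? n
  ... | yes h = fromℕ< h
  ... | no _ = p

IsBT : ∀ n → Word n → Set
IsBT n s = ∃[ i ] ∃[ j ] ∃[ k ] (i < j × j < k × k ≤ n × s ≡ σ n i j k)

Adj : ∀ {n} → Word n → Word n → Set
Adj {n} π ρ = ∃[ s ] (IsBT n s × ρ ≡ π ∘ₚ s)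

Bset : ∀ n → Word n → Set
Bset n ρ = ∃[ j ] (1 ≤ j × j ≤ n ∸ 1 × ρ ≡ σ n 0 j n)

Lset : ∀ n → Word n → Set
Lset n ρ = ∃[ j ] ∃[ k ] (0 < j × j < k × k ≤ n ∸ 1 × ρ ≡ σ n 0 j k)

Fset : ∀ n → Word n → Set
Fset n ρ = ∃[ i ] ∃[ j ] (1 ≤ i × i < j × j < n × ρ ≡ σ n i j n)

HasExactly : ∀ {A : Set} → ℕ → (A → Set) → Set
HasExactly {A} m P =
  ∃[ xs ] (length xs ≡ m × Unique xs × (∀ (x : A) → (x ∈ xs → P x) × (P x → x ∈ xs)))

-- Every vertex of B, L and F is a block transposition, and is handled through the map it
-- induces on positions.
-- For uniqueness, an edge π ∼ ρ makes ρ⁻¹ ∘ π a block transposition, which has at most three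
-- breakpoints, while every wrong candidate ρ gives ρ⁻¹ ∘ π four breakpoints. Finally, the
-- neighbours of σ(0, m, n) in L ∪ F are σ(0, m, k) for m < k < n and σ(i, m, n) for
-- 0 < i < m: these are n − 2 distinct vertices.
module Submission where

open import Defs
open import Data.Nat using (ℕ; zero; suc; _+_; _∸_; _≤_; _<_; _<?_; _≟_; z≤n; s≤s; z<s)
open import Data.Nat.Properties
open import Algebra.Properties.CommutativeSemigroup +-commutativeSemigroup
  using (xy∙z≈xz∙y; xy∙z≈y∙xz; xy∙z≈yx∙z; x∙yz≈yx∙z)
open import Data.Product using (∃-syntax; _×_; _,_; proj₁; proj₂)
open import Data.Sum using (_⊎_; inj₁; inj₂)
open import Data.Empty using (⊥)
open import Function using (_∘_; _∋_; case_of_)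
open import Data.Fin using (Fin; toℕ; fromℕ<)
open import Data.Fin.Properties using (toℕ-fromℕ<; toℕ<n; toℕ-injective)
open import Data.Vec using (lookup; tabulate)
open import Data.Vec.Properties using (lookup∘tabulate; tabulate∘lookup; tabulate-cong)
open import Data.List using (List; _∷_; []; _++_; length; applyDownFrom)
open import Data.List.Properties using (length-++; length-applyDownFrom)
open import Data.List.Membership.Propositional using (_∈_)
open import Data.List.Membership.Propositional.Properties using (∈-applyDownFrom⁺; ∈-applyDownFrom⁻; ∈-++⁺ˡ; ∈-++⁺ʳ; ∈-++⁻)
open import Data.List.Relation.Unary.Unique.Propositional using (Unique)
open import Data.List.Relation.Unary.Unique.Propositional.Properties using (++⁺; applyDownFrom⁺₁)
open import Data.List.Relation.Unary.Any using (here; there)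
open import Data.List.Relation.Unary.All using ([])
open import Data.List.Relation.Unary.AllPairs using ([]; _∷_)
open import Data.Nat.Tactic.RingSolver using (solve)
open import Relation.Nullary using (¬_; yes; no; contradiction)
open import Relation.Nullary.Decidable using (decidable-stable; _×-dec_)
open import Relation.Binary.PropositionalEquality

opaque
  bt : ℕ → ℕ → ℕ → ℕ → ℕ
  bt i a c = btMap i (i + a) (i + a + c)

opaque
  unfolding bt

  bt-before : ∀ {i a c p} → p < i → bt i a c p ≡ p
  bt-before {i} {p = p} p<i with p <? i
  ... | yes _ = refl
  ... | no p≮i = contradiction p<i p≮i

  bt-front : ∀ {i a c t} → t < c → bt i a c (i + t) ≡ i + a + t
  bt-front {i} {a} {c} {t} t<c with i + t <? i
  ... | yes i+t<i = contradiction i+t<i (m+n≮m i t)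
  ... | no _ with i + t <? i + (i + a + c ∸ (i + a))
  ...   | yes _ = trans (cong (i + t +_) (m+n∸m≡n i a)) (xy∙z≈xz∙y i t a)
  ...   | no ≮ = contradiction (subst (λ d → i + t < i + d) (sym (m+n∸m≡n (i + a) c)) (+-monoʳ-< i t<c)) ≮

  bt-back : ∀ {i a c t} → t < a → bt i a c (i + c + t) ≡ i + t
  bt-back {i} {a} {c} {t} t<a with i + c + t <? i
  ... | yes <i = contradiction (≤-trans (m≤m+n i c) (m≤m+n (i + c) t)) (<⇒≱ <i)
  ... | no _ with i + c + t <? i + (i + a + c ∸ (i + a))
  ...   | yes <i+c = contradiction (m≤m+n (i + c) t) (<⇒≱ (subst (λ d → i + c + t < i + d) (m+n∸m≡n (i + a) c) <i+c))
  ...   | no _ with i + c + t <? i + a + c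
  ...     | yes _ = trans (cong (i + c + t ∸_) (m+n∸m≡n (i + a) c)) (trans (cong (_∸ c) (xy∙z≈xz∙y i c t)) (m+n∸n≡m (i + t) c))
  ...     | no ≮ = contradiction (subst (i + c + t <_) (xy∙z≈xz∙y i c a) (+-monoʳ-< (i + c) t<a)) ≮

  bt-after : ∀ {i a c p} → i + a + c ≤ p → bt i a c p ≡ p
  bt-after {i} {a} {c} {p} i+a+c≤p with p <? i
  ... | yes p<i = contradiction (≤-trans (m≤m+n i (a + c)) (subst (_≤ p) (+-assoc i a c) i+a+c≤p)) (<⇒≱ p<i)
  ... | no _ with p <? i + (i + a + c ∸ (i + a))
  ...   | yes p<i+c = contradiction (≤-trans (subst (i + c ≤_) (xy∙z≈xz∙y i c a) (m≤m+n (i + c) a)) i+a+c≤p)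
                        (<⇒≱ (subst (λ d → p < i + d) (m+n∸m≡n (i + a) c) p<i+c))
  ...   | no _ with p <? i + a + c
  ...     | yes p<k = contradiction i+a+c≤p (<⇒≱ p<k)
  ...     | no _ = refl

data Region (i a c : ℕ) : ℕ → Set where
  before : ∀ {p} → p < i → Region i a c p
  front  : ∀ {t} → t < c → Region i a c (i + t)
  back   : ∀ {t} → t < a → Region i a c (i + c + t)
  after  : ∀ t → Region i a c (i + a + c + t)

region : ∀ i a c p → Region i a c p
region i a c p with p <? i
... | yes p<i = before p<i
... | no p≮i with m≤n⇒∃[o]m+o≡n (≮⇒≥ p≮i)
...   | t , refl with t <? c
...     | yes t<c = front t<c
...     | no t≮c with m≤n⇒∃[o]m+o≡n (≮⇒≥ t≮c)
...       | u , refl with u <? a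
...         | yes u<a = subst (Region i a c) (+-assoc i c u) (back u<a)
...         | no u≮a with m≤n⇒∃[o]m+o≡n (≮⇒≥ u≮a)
...           | w , refl = subst (Region i a c) i+a+c+w≡i+[c+[a+w]] (after w)
  where
  i+a+c+w≡i+[c+[a+w]] : i + a + c + w ≡ i + (c + (a + w))
  i+a+c+w≡i+[c+[a+w]] = solve (i ∷ a ∷ c ∷ w ∷ [])

bt-inverse : ∀ i a c p → bt i c a (bt i a c p) ≡ p
bt-inverse i a c p with region i a c p
... | before p<i   = trans (cong (bt i c a) (bt-before p<i)) (bt-before p<i)
... | front t<c    = trans (cong (bt i c a) (bt-front t<c)) (bt-back t<c)
... | back t<a     = trans (cong (bt i c a) (bt-back t<a)) (bt-front t<a)
... | after t      = trans (cong (bt i c a) (bt-after k≤p)) (bt-after (subst (_≤ i + a + c + t) (xy∙z≈xz∙y i a c) k≤p))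
  where
  k≤p : i + a + c ≤ i + a + c + t
  k≤p = m≤m+n (i + a + c) t

bt-injective : ∀ {i a c x y} → bt i a c x ≡ bt i a c y → x ≡ y
bt-injective {i} {a} {c} {x} {y} eq =
  trans (sym (bt-inverse i a c x)) (trans (cong (bt i c a) eq) (bt-inverse i a c y))

bt-< : ∀ {i a c n p} → i + a + c ≤ n → p < n → bt i a c p < n
bt-< {i} {a} {c} {n} {p} fits p<n with region i a c p
... | before p<i  = subst (_< n) (sym (bt-before p<i)) p<n
... | front {t} t<c  = subst (_< n) (sym (bt-front t<c))
                          (<-≤-trans (+-monoʳ-< (i + a) t<c) fits)
... | back {t} t<a = subst (_< n) (sym (bt-back t<a)) (≤-<-trans (+-monoˡ-≤ t (m≤m+n i c)) p<n)
... | after t    = subst (_< n) (sym (bt-after (m≤m+n (i + a + c) t))) p<n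

bt-front₀ : ∀ {i a c} → 1 ≤ c → bt i a c i ≡ i + a
bt-front₀ {i} {a} {c} 1≤c =
  trans (cong (bt i a c) (sym (+-identityʳ i))) (trans (bt-front 1≤c) (+-identityʳ (i + a)))

bt-back₀ : ∀ {i a c} → 1 ≤ a → bt i a c (i + c) ≡ i
bt-back₀ {i} {a} {c} 1≤a =
  trans (cong (bt i a c) (sym (+-identityʳ (i + c)))) (trans (bt-back 1≤a) (+-identityʳ i))

bt[0,a,c]∘bt[c,a,e]≗bt[0,a,c+e] : ∀ a c e x → bt 0 a c (bt c a e x) ≡ bt 0 a (c + e) x
bt[0,a,c]∘bt[c,a,e]≗bt[0,a,c+e] a c e x with region c a e x
... | before x<c =
  trans (cong (bt 0 a c) (bt-before x<c))
    (trans (bt-front {0} {a} {c} x<c) (sym (bt-front {0} {a} {c + e} (≤-trans x<c (m≤m+n c e)))))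
... | front {t} t<e =
  trans (cong (bt 0 a c) (bt-front t<e))
    (trans (bt-after {0} {a} {c} (subst (_≤ c + a + t) (+-comm c a) (m≤m+n (c + a) t)))
      (trans (xy∙z≈y∙xz c a t) (sym (bt-front {0} {a} {c + e} (+-monoʳ-< c t<e)))))
... | back {t} t<a =
  trans (cong (bt 0 a c) (bt-back t<a))
    (trans (bt-back {0} {a} {c} t<a) (sym (bt-back {0} {a} {c + e} t<a)))
... | after t =
  trans (cong (bt 0 a c) (bt-after (m≤m+n (c + a + e) t)))
    (trans (bt-after {0} {a} {c} (≤-trans (≤-reflexive (+-comm a c)) (≤-trans (m≤m+n (c + a) e) (m≤m+n _ t))))
      (sym (bt-after {0} {a} {c + e} (≤-trans (≤-reflexive (x∙yz≈yx∙z a c e)) (m≤m+n _ t)))))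

bt[i,a,c]∘bt[0,i,c]≗bt[0,i+a,c] : ∀ i a c x → bt i a c (bt 0 i c x) ≡ bt 0 (i + a) c x
bt[i,a,c]∘bt[0,i,c]≗bt[0,i+a,c] i a c x with region 0 i c x
... | front {t} t<c =
  trans (cong (bt i a c) (bt-front {0} {i} {c} t<c))
    (trans (bt-front t<c) (sym (bt-front {0} {i + a} {c} t<c)))
... | back {t} t<i =
  trans (cong (bt i a c) (bt-back {0} {i} {c} t<i))
    (trans (bt-before t<i) (sym (bt-back {0} {i + a} {c} (≤-trans t<i (m≤m+n i a)))))
... | after t with t <? a
...   | yes t<a =
  trans (cong (bt i a c) (bt-after {0} {i} {c} (m≤m+n (i + c) t)))
    (trans (bt-back t<a)
      (sym (trans (cong (bt 0 (i + a) c) (xy∙z≈y∙xz i c t)) (bt-back {0} {i + a} {c} (+-monoʳ-< i t<a)))))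
...   | no t≮a =
  trans (cong (bt i a c) (bt-after {0} {i} {c} (m≤m+n (i + c) t)))
    (trans (bt-after (≤-trans (≤-reflexive (xy∙z≈xz∙y i a c)) i+c+a≤i+c+t))
      (sym (bt-after {0} {i + a} {c} (≤-trans (≤-reflexive (xy∙z≈xz∙y i a c)) i+c+a≤i+c+t))))
  where
  i+c+a≤i+c+t : i + c + a ≤ i + c + t
  i+c+a≤i+c+t = +-monoʳ-≤ (i + c) (≮⇒≥ t≮a)

bt[0,a,c]∘bt[0,c,a+e]≗bt[a,c,e] : ∀ a c e x → bt 0 a c (bt 0 c (a + e) x) ≡ bt a c e x
bt[0,a,c]∘bt[0,c,a+e]≗bt[a,c,e] a c e x with region 0 c (a + e) x
... | back {t} t<c =
  trans (cong (bt 0 a c) (bt-back {0} {c} {a + e} t<c))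
    (trans (bt-front {0} {a} {c} t<c) (sym (bt-back t<c)))
... | after t =
  trans (cong (bt 0 a c) (bt-after {0} {c} {a + e} (m≤m+n (c + (a + e)) t)))
    (trans (bt-after {0} {a} {c} (≤-trans (≤-reflexive (+-comm a c)) (≤-trans (m≤m+n (c + a) e) c+a+e≤x)))
      (sym (bt-after (≤-trans (≤-reflexive (xy∙z≈yx∙z a c e)) c+a+e≤x))))
  where
  c+a+e≤x : c + a + e ≤ c + (a + e) + t
  c+a+e≤x = ≤-trans (≤-reflexive (+-assoc c a e)) (m≤m+n (c + (a + e)) t)
... | front {t} t<a+e with t <? a
...   | yes t<a =
  trans (cong (bt 0 a c) (bt-front {0} {c} {a + e} t<a+e))
    (trans (bt-back {0} {a} {c} t<a) (sym (bt-before t<a)))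
...   | no t≮a with u , refl ← m≤n⇒∃[o]m+o≡n (≮⇒≥ t≮a) =
  trans (cong (bt 0 a c) (bt-front {0} {c} {a + e} t<a+e))
    (trans (bt-after {0} {a} {c} (≤-trans (≤-reflexive (+-comm a c)) (≤-trans (m≤m+n (c + a) u) (≤-reflexive (+-assoc c a u)))))
      (trans (x∙yz≈yx∙z c a u) (sym (bt-front (+-cancelˡ-< a u e t<a+e)))))

-- Breakpoints

-- At position 0, f is compared with the sentinel f(−1) = −1.
Breakpoint : (ℕ → ℕ) → ℕ → Set
Breakpoint f zero    = f zero ≢ zero
Breakpoint f (suc x) = f (suc x) ≢ suc (f x)

Breakpoint-cong : ∀ {f g} u → (∀ x → x ≤ u → f x ≡ g x) → Breakpoint f u → Breakpoint g u
Breakpoint-cong zero    f≗g b e = b (trans (f≗g 0 z≤n) e)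
Breakpoint-cong (suc x) f≗g b e =
  b (trans (f≗g (suc x) ≤-refl) (trans e (cong suc (sym (f≗g x (n≤1+n x))))))

IsCut : ℕ → ℕ → ℕ → ℕ → Set
IsCut i a c u = u ≡ i ⊎ u ≡ i + c ⊎ u ≡ i + a + c

bt-breakpoint : ∀ {i a c} u → Breakpoint (bt i a c) u → IsCut i a c u
bt-breakpoint {zero}  zero b = inj₁ refl
bt-breakpoint {suc i} zero b = contradiction (bt-before z<s) b
bt-breakpoint {i} {a} {c} (suc x) b with region i a c x
... | before x<i with suc x <? i
...   | yes sx<i = contradiction (trans (bt-before sx<i) (cong suc (sym (bt-before x<i)))) b
...   | no sx≮i  = inj₁ (≤-antisym x<i (≮⇒≥ sx≮i))
bt-breakpoint {i} {a} {c} (suc x) b | front {t} t<c with suc t <? c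
...   | yes st<c = contradiction step b
  where
  step : bt i a c (suc (i + t)) ≡ suc (bt i a c (i + t))
  step = begin
    bt i a c (suc (i + t))  ≡⟨ cong (bt i a c) (sym (+-suc i t)) ⟩
    bt i a c (i + suc t)    ≡⟨ bt-front st<c ⟩
    i + a + suc t           ≡⟨ +-suc (i + a) t ⟩
    suc (i + a + t)         ≡⟨ cong suc (sym (bt-front t<c)) ⟩
    suc (bt i a c (i + t))  ∎
    where open ≡-Reasoning
...   | no st≮c = inj₂ (inj₁ (trans (sym (+-suc i t)) (cong (i +_) (≤-antisym t<c (≮⇒≥ st≮c)))))
bt-breakpoint {i} {a} {c} (suc x) b | back {t} t<a with suc t <? a
...   | yes st<a = contradiction step b
  where
  step : bt i a c (suc (i + c + t)) ≡ suc (bt i a c (i + c + t))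
  step = begin
    bt i a c (suc (i + c + t))  ≡⟨ cong (bt i a c) (sym (+-suc (i + c) t)) ⟩
    bt i a c (i + c + suc t)    ≡⟨ bt-back st<a ⟩
    i + suc t                   ≡⟨ +-suc i t ⟩
    suc (i + t)                 ≡⟨ cong suc (sym (bt-back t<a)) ⟩
    suc (bt i a c (i + c + t))  ∎
    where open ≡-Reasoning
...   | no st≮a = inj₂ (inj₂ (begin
    suc (i + c + t)  ≡⟨ sym (+-suc (i + c) t) ⟩
    i + c + suc t    ≡⟨ cong (i + c +_) (≤-antisym t<a (≮⇒≥ st≮a)) ⟩
    i + c + a        ≡⟨ xy∙z≈xz∙y i c a ⟩
    i + a + c        ∎))
    where open ≡-Reasoning
bt-breakpoint {i} {a} {c} (suc x) b | after t =
  contradiction (trans (bt-after (≤-trans k≤p (n≤1+n _))) (cong suc (sym (bt-after k≤p)))) b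
  where
  k≤p : i + a + c ≤ i + a + c + t
  k≤p = m≤m+n (i + a + c) t

IsCut-≥ : ∀ {i a c u} → IsCut i a c u → i ≤ u
IsCut-≥ {i} {a} {c} (inj₁ refl)        = ≤-refl
IsCut-≥ {i} {a} {c} (inj₂ (inj₁ refl)) = m≤m+n i c
IsCut-≥ {i} {a} {c} (inj₂ (inj₂ refl)) = ≤-trans (m≤m+n i a) (m≤m+n (i + a) c)

IsCut-≤ : ∀ {i a c u} → IsCut i a c u → u ≤ i + a + c
IsCut-≤ {i} {a} {c} (inj₁ refl)        = ≤-trans (m≤m+n i a) (m≤m+n (i + a) c)
IsCut-≤ {i} {a} {c} (inj₂ (inj₁ refl)) = subst (i + c ≤_) (xy∙z≈xz∙y i c a) (m≤m+n (i + c) a)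
IsCut-≤ {i} {a} {c} (inj₂ (inj₂ refl)) = ≤-refl

IsCut-i<⇒i+c≤ : ∀ {i a c u} → IsCut i a c u → i < u → i + c ≤ u
IsCut-i<⇒i+c≤ (inj₁ refl)        i<u = contradiction i<u (<-irrefl refl)
IsCut-i<⇒i+c≤ (inj₂ (inj₁ refl)) _   = ≤-refl
IsCut-i<⇒i+c≤ {i} {a} {c} (inj₂ (inj₂ refl)) _ = IsCut-≤ {i} {a} {c} (inj₂ (inj₁ refl))

IsCut-i+c<⇒≡i+a+c : ∀ {i a c u} → IsCut i a c u → i + c < u → u ≡ i + a + c
IsCut-i+c<⇒≡i+a+c {i} (inj₁ refl)        i+c<u = contradiction (m≤m+n i _) (<⇒≱ i+c<u)
IsCut-i+c<⇒≡i+a+c (inj₂ (inj₁ refl)) i+c<u = contradiction i+c<u (<-irrefl refl)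
IsCut-i+c<⇒≡i+a+c (inj₂ (inj₂ refl)) _     = refl

bt-≤3-breakpoints : ∀ {i a c u₀ u₁ u₂ u₃} → u₀ < u₁ → u₁ < u₂ → u₂ < u₃ →
  Breakpoint (bt i a c) u₀ → Breakpoint (bt i a c) u₁ → Breakpoint (bt i a c) u₂ → Breakpoint (bt i a c) u₃ → ⊥
bt-≤3-breakpoints {i} {a} {c} {u₀} {u₁} {u₂} {u₃} u₀<u₁ u₁<u₂ u₂<u₃ b₀ b₁ b₂ b₃ =
  <⇒≱ (subst (_< u₃) u₂≡i+a+c u₂<u₃) (IsCut-≤ (bt-breakpoint u₃ b₃))
  where
  i+c≤u₁ : i + c ≤ u₁
  i+c≤u₁ = IsCut-i<⇒i+c≤ (bt-breakpoint u₁ b₁) (≤-<-trans (IsCut-≥ (bt-breakpoint u₀ b₀)) u₀<u₁)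
  u₂≡i+a+c : u₂ ≡ i + a + c
  u₂≡i+a+c = IsCut-i+c<⇒≡i+a+c (bt-breakpoint u₂ b₂) (≤-<-trans i+c≤u₁ u₁<u₂)

bt-successor-value : ∀ {i a c x y} → 1 ≤ a → 1 ≤ c → bt i a c y ≡ suc (bt i a c x) →
  y ≡ suc x ⊎ (suc x ≡ i × y ≡ i + c) ⊎ (suc x ≡ i + c × y ≡ i + a + c) ⊎ (suc x ≡ i + a + c × y ≡ i)
bt-successor-value {i} {a} {c} {x} {y} 1≤a 1≤c eq with bt i a c (suc x) ≟ suc (bt i a c x)
... | yes step = inj₁ (bt-injective (trans eq (sym step)))
... | no b with bt-breakpoint (suc x) b
...   | inj₁ sx≡i = inj₂ (inj₁ (sx≡i , bt-injective (begin
          bt i a c y        ≡⟨ eq ⟩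
          suc (bt i a c x)  ≡⟨ cong suc (bt-before (≤-reflexive sx≡i)) ⟩
          suc x             ≡⟨ sx≡i ⟩
          i                 ≡⟨ bt-back₀ 1≤a ⟨
          bt i a c (i + c)  ∎)))
  where open ≡-Reasoning
bt-successor-value {i} {a} {suc c} {x} {y} 1≤a 1≤c eq | no b | inj₂ (inj₁ sx≡i+c) =
  inj₂ (inj₂ (inj₁ (sx≡i+c , bt-injective (begin
    bt i a (suc c) y        ≡⟨ eq ⟩
    suc (bt i a (suc c) x)  ≡⟨ cong (suc ∘ bt i a (suc c)) x≡i+c ⟩
    suc (bt i a (suc c) (i + c))  ≡⟨ cong suc (bt-front ≤-refl) ⟩
    suc (i + a + c)         ≡⟨ +-suc (i + a) c ⟨
    i + a + suc c           ≡⟨ bt-after ≤-refl ⟨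
    bt i a (suc c) (i + a + suc c)  ∎))))
  where
  open ≡-Reasoning
  x≡i+c : x ≡ i + c
  x≡i+c = suc-injective (trans sx≡i+c (+-suc i c))
bt-successor-value {i} {suc a} {c} {x} {y} 1≤a 1≤c eq | no b | inj₂ (inj₂ sx≡end) =
  inj₂ (inj₂ (inj₂ (sx≡end , bt-injective (begin
    bt i (suc a) c y        ≡⟨ eq ⟩
    suc (bt i (suc a) c x)  ≡⟨ cong (suc ∘ bt i (suc a) c) x≡i+c+a ⟩
    suc (bt i (suc a) c (i + c + a))  ≡⟨ cong suc (bt-back ≤-refl) ⟩
    suc (i + a)             ≡⟨ +-suc i a ⟨
    i + suc a               ≡⟨ bt-front₀ 1≤c ⟨
    bt i (suc a) c i        ∎))))
  where
  open ≡-Reasoning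
  x≡i+c+a : x ≡ i + c + a
  x≡i+c+a = suc-injective (begin
    suc x            ≡⟨ sx≡end ⟩
    i + suc a + c    ≡⟨ xy∙z≈xz∙y i (suc a) c ⟩
    i + c + suc a    ≡⟨ +-suc (i + c) a ⟩
    suc (i + c + a)  ∎)

-- Agreement on the closed interval [0, n] is what detects a breakpoint at n.
IsBtUpTo : ℕ → (ℕ → ℕ) → Set
IsBtUpTo n g = ∃[ i ] ∃[ a ] ∃[ c ] (∀ x → x ≤ n → g x ≡ bt i a c x)

IsBtUpTo-≤3-breakpoints : ∀ {n g u₀ u₁ u₂ u₃} → IsBtUpTo n g → u₀ < u₁ → u₁ < u₂ → u₂ < u₃ → u₃ ≤ n →
  Breakpoint g u₀ → Breakpoint g u₁ → Breakpoint g u₂ → Breakpoint g u₃ → ⊥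
IsBtUpTo-≤3-breakpoints {n} {g} {u₃ = u₃} (i , a , c , g≗bt) u₀<u₁ u₁<u₂ u₂<u₃ u₃≤n b₀ b₁ b₂ b₃ =
  bt-≤3-breakpoints u₀<u₁ u₁<u₂ u₂<u₃
    (transfer (<⇒≤ (<-trans u₀<u₁ (<-trans u₁<u₂ u₂<u₃))) b₀)
    (transfer (<⇒≤ (<-trans u₁<u₂ u₂<u₃)) b₁) (transfer (<⇒≤ u₂<u₃) b₂) (transfer ≤-refl b₃)
  where
  transfer : ∀ {u} → u ≤ u₃ → Breakpoint g u → Breakpoint (bt i a c) u
  transfer {u} u≤u₃ = Breakpoint-cong u (λ x x≤u → g≗bt x (≤-trans x≤u (≤-trans u≤u₃ u₃≤n)))

-- Words and their maps on positions

record _Represents_ {n} (w : Word n) (f : ℕ → ℕ) : Set where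
  constructor represents
  field lookup-toℕ : ∀ p → toℕ (lookup w p) ≡ f (toℕ p)
open _Represents_

Represents-agree : ∀ {n} {w : Word n} {f g x} → w Represents f → w Represents g → x < n → f x ≡ g x
Represents-agree {w = w} {f} {g} {x} wf wg x<n = begin
  f x                             ≡⟨ cong f (toℕ-fromℕ< x<n) ⟨
  f (toℕ (fromℕ< x<n))            ≡⟨ lookup-toℕ wf (fromℕ< x<n) ⟨
  toℕ (lookup w (fromℕ< x<n))     ≡⟨ lookup-toℕ wg (fromℕ< x<n) ⟩
  g (toℕ (fromℕ< x<n))            ≡⟨ cong g (toℕ-fromℕ< x<n) ⟩
  g x                             ∎
  where open ≡-Reasoning

Represents-≡ : ∀ {n} {w w′ : Word n} {f g} → w Represents f → w′ Represents g →
  (∀ x → x < n → f x ≡ g x) → w ≡ w′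
Represents-≡ {w = w} {w′} {f} {g} wf w′g f≗g = begin
  w                  ≡⟨ tabulate∘lookup w ⟨
  tabulate (lookup w)  ≡⟨ tabulate-cong (λ p → toℕ-injective (begin
    toℕ (lookup w p)   ≡⟨ lookup-toℕ wf p ⟩
    f (toℕ p)          ≡⟨ f≗g (toℕ p) (toℕ<n p) ⟩
    g (toℕ p)          ≡⟨ lookup-toℕ w′g p ⟨
    toℕ (lookup w′ p)  ∎)) ⟩
  tabulate (lookup w′) ≡⟨ tabulate∘lookup w′ ⟩
  w′                 ∎
  where open ≡-Reasoning

Represents-∘ : ∀ {n} {π s : Word n} {f g} → π Represents f → s Represents g → (π ∘ₚ s) Represents (f ∘ g)
Represents-∘ {π = π} {s} {f} πf sg = represents λ p →
  trans (cong toℕ (lookup∘tabulate _ p)) (trans (lookup-toℕ πf (lookup s p)) (cong f (lookup-toℕ sg p)))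

σ-lookup : ∀ n i j k (p : Fin n) → btMap i j k (toℕ p) < n → toℕ (lookup (σ n i j k) p) ≡ btMap i j k (toℕ p)
σ-lookup n i j k p inRange with lookup (σ n i j k) p | lookup (σ n i j k) p ≡ _ ∋ lookup∘tabulate _ p
... | y | y≡entry with btMap i j k (toℕ p) <? n
...   | yes inRange′ = trans (cong toℕ y≡entry) (toℕ-fromℕ< inRange′)
...   | no outOfRange = contradiction inRange outOfRange

opaque
  unfolding bt

  σ-Represents-bt : ∀ {n i a c} → i + a + c ≤ n → σ n i (i + a) (i + a + c) Represents bt i a c
  σ-Represents-bt {n} {i} {a} {c} fits =
    represents λ p → σ-lookup n i (i + a) (i + a + c) p (bt-< {i} {a} {c} fits (toℕ<n p))

i+[j∸i]+[k∸j]≡k : ∀ {i j k} → i ≤ j → j ≤ k → i + (j ∸ i) + (k ∸ j) ≡ k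
i+[j∸i]+[k∸j]≡k {i} {j} {k} i≤j j≤k = trans (cong (_+ (k ∸ j)) (m+[n∸m]≡n i≤j)) (m+[n∸m]≡n j≤k)

σ-Represents : ∀ {n i j k} → i < j → j < k → k ≤ n → σ n i j k Represents bt i (j ∸ i) (k ∸ j)
σ-Represents {n} {i} {j} {k} i<j j<k k≤n =
  subst₂ (λ j′ k′ → σ n i j′ k′ Represents bt i (j ∸ i) (k ∸ j)) (m+[n∸m]≡n (<⇒≤ i<j)) telescope
    (σ-Represents-bt (subst (_≤ n) (sym telescope) k≤n))
  where
  telescope : i + (j ∸ i) + (k ∸ j) ≡ k
  telescope = i+[j∸i]+[k∸j]≡k (<⇒≤ i<j) (<⇒≤ j<k)

Adjℕ : ℕ → (ℕ → ℕ) → (ℕ → ℕ) → Set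
Adjℕ n f g = ∃[ i ] ∃[ a ] ∃[ c ] (1 ≤ a × 1 ≤ c × i + a + c ≤ n × (∀ x → x < n → g x ≡ f (bt i a c x)))

Adj⇒Adjℕ : ∀ {n} {π ρ : Word n} {f g} → π Represents f → ρ Represents g → Adj π ρ → Adjℕ n f g
Adj⇒Adjℕ {n} πf ρg (_ , (i , j , k , i<j , j<k , k≤n , refl) , refl) =
  i , j ∸ i , k ∸ j , m<n⇒0<n∸m i<j , m<n⇒0<n∸m j<k , subst (_≤ n) (sym (i+[j∸i]+[k∸j]≡k (<⇒≤ i<j) (<⇒≤ j<k))) k≤n ,
  λ x x<n → Represents-agree ρg (Represents-∘ πf (σ-Represents i<j j<k k≤n)) x<n

Adjℕ⇒Adj : ∀ {n} {π ρ : Word n} {f g} → π Represents f → ρ Represents g → Adjℕ n f g → Adj π ρ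
Adjℕ⇒Adj {n} πf ρg (i , a , c , 1≤a , 1≤c , fits , g≗f∘bt) =
  σ n i (i + a) (i + a + c) , (i , i + a , i + a + c , m<m+n i 1≤a , m<m+n (i + a) 1≤c , fits , refl) ,
  Represents-≡ ρg (Represents-∘ πf (σ-Represents-bt fits)) g≗f∘bt

Adjℕ-sym : ∀ {n f g} → Adjℕ n f g → Adjℕ n g f
Adjℕ-sym {n} {f} {g} (i , a , c , 1≤a , 1≤c , fits , g≗f∘bt) =
  i , c , a , 1≤c , 1≤a , fits′ ,
  λ x x<n → trans (cong f (sym (bt-inverse i c a x))) (sym (g≗f∘bt _ (bt-< fits′ x<n)))
  where
  fits′ : i + c + a ≤ n
  fits′ = subst (_≤ n) (xy∙z≈xz∙y i a c) fits

Adj-sym : ∀ {n} {π ρ : Word n} {f g} → π Represents f → ρ Represents g → Adj π ρ → Adj ρ π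
Adj-sym πf ρg = Adjℕ⇒Adj ρg πf ∘ Adjℕ-sym ∘ Adj⇒Adjℕ πf ρg

-- bt i′ c′ a′ inverts bt i′ a′ c′, so the composite is ρ⁻¹ ∘ π.
Adjℕ-bt⇒IsBtUpTo : ∀ {n i a c i′ a′ c′} → i + a + c ≤ n → i′ + a′ + c′ ≤ n →
  Adjℕ n (bt i a c) (bt i′ a′ c′) → IsBtUpTo n (bt i′ c′ a′ ∘ bt i a c)
Adjℕ-bt⇒IsBtUpTo {n} {i} {a} {c} {i′} {a′} {c′} fits fits′ adj
  with I , A , C , _ , _ , Fits , f≗g∘bt ← Adjℕ-sym adj =
  I , A , C , λ x x≤n → case m≤n⇒m<n∨m≡n x≤n of λ where
    (inj₁ x<n) → trans (cong (bt i′ c′ a′) (f≗g∘bt x x<n)) (bt-inverse i′ a′ c′ _)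
    (inj₂ refl) → trans (cong (bt i′ c′ a′) (bt-after fits))
                    (trans (bt-after (subst (_≤ n) (xy∙z≈xz∙y i′ a′ c′) fits′)) (sym (bt-after Fits)))

-- Uniqueness of neighbours

Breakpoint-∘ : ∀ (h f : ℕ → ℕ) x {X Y} → f x ≡ X → f (suc x) ≡ Y → h Y ≢ suc (h X) → Breakpoint (h ∘ f) (suc x)
Breakpoint-∘ h f x refl refl h-jumps = h-jumps

Adjℕ-L-B-unique : ∀ {n a c m r} → 1 ≤ a → 1 ≤ c → 1 ≤ m → 1 ≤ r → a + c < n → m + r ≡ n →
  Adjℕ n (bt 0 a c) (bt 0 m r) → a ≡ m
Adjℕ-L-B-unique {a = a@(suc a′)} {c@(suc c′)} {m@(suc m′)} {r@(suc r′)} 1≤a 1≤c 1≤m 1≤r a+c<n refl adj =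
  decidable-stable (a ≟ m) λ a≢m →
    IsBtUpTo-≤3-breakpoints (Adjℕ-bt⇒IsBtUpTo (<⇒≤ a+c<n) ≤-refl adj) z<s
      (s≤s (s≤s (m≤m+n c′ a′))) (subst (_< m + r) (cong suc (+-comm a′ c)) a+c<n) ≤-refl
      (b₀ a≢m) b₁ (b₂ a≢m) bₙ
  where
  b₀ : a ≢ m → Breakpoint (bt 0 r m ∘ bt 0 a c) 0
  b₀ a≢m e = a≢m (bt-injective (trans (trans (cong (bt 0 r m) (sym (bt-front₀ {0} {a} 1≤c))) e) (sym (bt-back₀ {0} {r} {m} 1≤r))))
  b₁ : Breakpoint (bt 0 r m ∘ bt 0 a c) c
  b₁ = Breakpoint-∘ (bt 0 r m) (bt 0 a c) c′ (bt-front {0} {a} {c} ≤-refl) (bt-back₀ {0} {a} {c} 1≤a) λ e →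
    case bt-successor-value {0} {r} {m} 1≤r 1≤m e of λ where
    (inj₁ ())
    (inj₂ (inj₂ (inj₁ (_ , ()))))
    (inj₂ (inj₂ (inj₂ (a+c≡n , _)))) → <⇒≢ a+c<n (trans (+-suc a c′) (trans a+c≡n (+-comm r m)))
  b₂ : a ≢ m → Breakpoint (bt 0 r m ∘ bt 0 a c) (suc (c + a′))
  b₂ a≢m = Breakpoint-∘ (bt 0 r m) (bt 0 a c) (c + a′) (bt-back {0} {a} {c} ≤-refl)
    (bt-after {0} {a} {c} (≤-reflexive (cong suc (+-comm a′ c)))) λ e →
    case bt-successor-value {0} {r} {m} 1≤r 1≤m e of λ where
      (inj₁ e) → m≢1+n+m a′ (sym (suc-injective e))
      (inj₂ (inj₂ (inj₁ (a≡m , _)))) → a≢m a≡m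
      (inj₂ (inj₂ (inj₂ (a≡n , _)))) → <⇒≱ a+c<n (≤-trans (≤-reflexive (trans (+-comm m r) (sym a≡n))) (m≤m+n a c))
  bₙ : Breakpoint (bt 0 r m ∘ bt 0 a c) (m + r)
  bₙ = Breakpoint-∘ (bt 0 r m) (bt 0 a c) (m′ + r) (bt-after {0} {a} {c} (≤-pred a+c<n))
    (bt-after {0} {a} {c} (<⇒≤ a+c<n)) λ e → m≢1+n+m r {m′} (begin
    r                             ≡⟨ cong suc (bt-back {0} {r} {m} ≤-refl) ⟨
    suc (bt 0 r m (m + r′))       ≡⟨ cong (suc ∘ bt 0 r m) (+-suc m′ r′) ⟨
    suc (bt 0 r m (m′ + r))       ≡⟨ e ⟨
    bt 0 r m (m + r)              ≡⟨ bt-after {0} {r} {m} (≤-reflexive (+-comm r m)) ⟩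
    m + r                         ∎)
    where open ≡-Reasoning

Adjℕ-F-B-unique : ∀ {n i a c m r} → 1 ≤ i → 1 ≤ a → 1 ≤ c → 1 ≤ m → 1 ≤ r → i + a + c ≡ n → m + r ≡ n →
  Adjℕ n (bt i a c) (bt 0 m r) → m ≡ i + a
Adjℕ-F-B-unique {i = i@(suc i′)} {a@(suc a′)} {c@(suc c′)} {m@(suc m′)} {r@(suc _)} _ 1≤a 1≤c 1≤m 1≤r i+a+c≡n refl adj =
  decidable-stable (m ≟ i + a) λ m≢i+a →
    IsBtUpTo-≤3-breakpoints (Adjℕ-bt⇒IsBtUpTo (≤-reflexive i+a+c≡n) ≤-refl adj) z<s
      (s≤s (s≤s (m≤m+n i′ c′))) (subst (_< m + r) (+-suc i c′) i+c<n) ≤-refl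
      b₀ b₁ b₂ (bₙ m≢i+a)
  where
  i+a<n : i + a < m + r
  i+a<n = subst (i + a <_) i+a+c≡n (m<m+n (i + a) 1≤c)
  i<n : i < m + r
  i<n = ≤-<-trans (m≤m+n i a) i+a<n
  i+c<n : i + c < m + r
  i+c<n = subst (i + c <_) (trans (xy∙z≈xz∙y i c a) i+a+c≡n) (m<m+n (i + c) 1≤a)
  b₀ : Breakpoint (bt 0 r m ∘ bt i a c) 0
  b₀ e = 1+n≢0 (trans (sym (bt-front₀ {0} {r} {m} 1≤m)) (trans (cong (bt 0 r m) (sym (bt-before {i} {a} {c} z<s))) e))
  b₁ : Breakpoint (bt 0 r m ∘ bt i a c) i
  b₁ = Breakpoint-∘ (bt 0 r m) (bt i a c) i′ (bt-before {i} {a} {c} ≤-refl) (bt-front₀ {i} {a} {c} 1≤c) λ e →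
    case bt-successor-value {0} {r} {m} 1≤r 1≤m e of λ where
      (inj₁ i+a≡i) → m+1+n≢m i i+a≡i
      (inj₂ (inj₂ (inj₁ (_ , i+a≡n)))) → <⇒≢ i+a<n (trans i+a≡n (+-comm r m))
      (inj₂ (inj₂ (inj₂ (i≡n , _)))) → <⇒≢ i<n (trans i≡n (+-comm r m))
  b₂ : Breakpoint (bt 0 r m ∘ bt i a c) (suc (i + c′))
  b₂ = Breakpoint-∘ (bt 0 r m) (bt i a c) (i + c′) (bt-front {i} {a} {c} ≤-refl)
    (trans (cong (bt i a c) (sym (+-suc i c′))) (bt-back₀ {i} {a} {c} 1≤a)) λ e →
    case bt-successor-value {0} {r} {m} 1≤r 1≤m e of λ where
      (inj₁ i≡1+i+a+c′) → <⇒≢ (s≤s (≤-trans (m≤m+n i a) (m≤m+n (i + a) c′))) i≡1+i+a+c′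
      (inj₂ (inj₂ (inj₁ (_ , i≡n)))) → <⇒≢ i<n (trans i≡n (+-comm r m))
      (inj₂ (inj₂ (inj₂ (_ , ()))))
  bₙ : m ≢ i + a → Breakpoint (bt 0 r m ∘ bt i a c) (m + r)
  bₙ m≢i+a = Breakpoint-∘ (bt 0 r m) (bt i a c) (m′ + r)
    (trans (cong (bt i a c) n-1≡i+c+a′) (bt-back {i} {a} {c} ≤-refl)) (bt-after {i} {a} {c} (≤-reflexive i+a+c≡n)) λ e →
    case bt-successor-value {0} {r} {m} 1≤r 1≤m e of λ where
      (inj₁ n≡i+a) → <⇒≢ i+a<n (trans (+-suc i a′) (sym n≡i+a))
      (inj₂ (inj₂ (inj₁ (i+a≡m , _)))) → m≢i+a (sym (trans (+-suc i a′) i+a≡m))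
      (inj₂ (inj₂ (inj₂ (i+a≡n , _)))) → <⇒≢ i+a<n (trans (+-suc i a′) (trans i+a≡n (+-comm r m)))
    where
    n-1≡i+c+a′ : m′ + r ≡ i + c + a′
    n-1≡i+c+a′ = suc-injective (begin
      m + r            ≡⟨ i+a+c≡n ⟨
      i + a + c        ≡⟨ xy∙z≈xz∙y i a c ⟩
      i + c + a        ≡⟨ +-suc (i + c) a′ ⟩
      suc (i + c + a′) ∎)
      where open ≡-Reasoning

Adjℕ-L-F-unique : ∀ {n a c i b e} → 1 ≤ a → 1 ≤ c → 1 ≤ i → 1 ≤ b → 1 ≤ e → a + c < n → i + b + e ≡ n →
  Adjℕ n (bt 0 a c) (bt i b e) → a ≡ i × c ≡ b
Adjℕ-L-F-unique {a = a@(suc a′)} {c@(suc c′)} {i@(suc _)} {b@(suc _)} {e@(suc e′)} 1≤a 1≤c _ 1≤b 1≤e a+c<n refl adj =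
  decidable-stable (a ≟ i ×-dec c ≟ b) λ ¬a≡i×c≡b →
    IsBtUpTo-≤3-breakpoints (Adjℕ-bt⇒IsBtUpTo (<⇒≤ a+c<n) ≤-refl adj) z<s
      (s≤s (s≤s (m≤m+n c′ a′))) (subst (λ x → suc x < suc (i + b + e′)) (+-comm a′ c) (subst (a + c <_) n≡1+n-1 a+c<n))
      (≤-reflexive (sym n≡1+n-1)) b₀ b₁ (b₂ ¬a≡i×c≡b) bₙ
  where
  n≡1+n-1 : i + b + e ≡ suc (i + b + e′)
  n≡1+n-1 = +-suc (i + b) e′
  b₀ : Breakpoint (bt i e b ∘ bt 0 a c) 0
  b₀ h[a]≡0 = 1+n≢0 (bt-injective (trans (trans (cong (bt i e b) (sym (bt-front₀ {0} {a} {c} 1≤c))) h[a]≡0)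
                                           (sym (bt-before {i} {e} {b} z<s))))
  b₁ : Breakpoint (bt i e b ∘ bt 0 a c) c
  b₁ = Breakpoint-∘ (bt i e b) (bt 0 a c) c′ (bt-front {0} {a} {c} ≤-refl) (bt-back₀ {0} {a} {c} 1≤a) λ jump →
    case bt-successor-value {i} {e} {b} 1≤e 1≤b jump of λ where
      (inj₁ ())
      (inj₂ (inj₁ (_ , ())))
      (inj₂ (inj₂ (inj₁ (_ , ()))))
      (inj₂ (inj₂ (inj₂ (_ , ()))))
  b₂ : ¬ (a ≡ i × c ≡ b) → Breakpoint (bt i e b ∘ bt 0 a c) (suc (c + a′))
  b₂ ¬a≡i×c≡b = Breakpoint-∘ (bt i e b) (bt 0 a c) (c + a′) (bt-back {0} {a} {c} ≤-refl)
    (bt-after {0} {a} {c} (≤-reflexive (cong suc (+-comm a′ c)))) λ jump →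
    case bt-successor-value {i} {e} {b} 1≤e 1≤b jump of λ where
      (inj₁ c+a′≡a′) → m≢1+n+m a′ (sym (suc-injective c+a′≡a′))
      (inj₂ (inj₁ (a≡i , a+c≡i+b))) →
        ¬a≡i×c≡b (a≡i , +-cancelˡ-≡ a c b (trans (cong suc (+-comm a′ c)) (trans a+c≡i+b (cong (_+ b) (sym a≡i)))))
      (inj₂ (inj₂ (inj₁ (_ , a+c≡n)))) →
        <⇒≢ a+c<n (trans (cong suc (+-comm a′ c)) (trans a+c≡n (xy∙z≈xz∙y i e b)))
      (inj₂ (inj₂ (inj₂ (a≡n , _)))) →
        <⇒≱ a+c<n (≤-trans (≤-reflexive (trans (xy∙z≈xz∙y i b e) (sym a≡n))) (m≤m+n a c))
  bₙ : Breakpoint (bt i e b ∘ bt 0 a c) (suc (i + b + e′))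
  bₙ = Breakpoint-∘ (bt i e b) (bt 0 a c) (i + b + e′)
    (bt-after {0} {a} {c} (≤-pred (subst (a + c <_) n≡1+n-1 a+c<n)))
    (bt-after {0} {a} {c} (subst (a + c ≤_) n≡1+n-1 (<⇒≤ a+c<n))) λ jump →
    m+1+n≢m (i + e′) (trans (xy∙z≈xz∙y i e′ b) (suc-injective (begin
      suc (i + b + e′)               ≡⟨ bt-after {i} {e} {b} (≤-trans (≤-reflexive (xy∙z≈xz∙y i e b)) (≤-reflexive n≡1+n-1)) ⟨
      bt i e b (suc (i + b + e′))    ≡⟨ jump ⟩
      suc (bt i e b (i + b + e′))    ≡⟨ cong suc (bt-back {i} {e} {b} ≤-refl) ⟩
      suc (i + e′)                   ∎)))
    where open ≡-Reasoning

L-Represents : ∀ {n j k} → 0 < j → j < k → k < n → σ n 0 j k Represents bt 0 j (k ∸ j)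
L-Represents 0<j j<k k<n = σ-Represents 0<j j<k (<⇒≤ k<n)

B-Represents : ∀ {n m} → 0 < m → m < n → σ n 0 m n Represents bt 0 m (n ∸ m)
B-Represents 0<m m<n = σ-Represents 0<m m<n ≤-refl

F-Represents : ∀ {n i j} → i < j → j < n → σ n i j n Represents bt i (j ∸ i) (n ∸ j)
F-Represents i<j j<n = σ-Represents i<j j<n ≤-refl

L-adj-B : ∀ {n j k} → 0 < j → j < k → k < n → Adj (σ n 0 j k) (σ n 0 j n)
L-adj-B {n} {j} {k} 0<j j<k k<n =
  Adjℕ⇒Adj (L-Represents 0<j j<k k<n) (B-Represents 0<j (<-trans j<k k<n))
    (k ∸ j , j , n ∸ k , 0<j , m<n⇒0<n∸m k<n ,
     ≤-reflexive (trans (cong (_+ (n ∸ k)) (+-comm (k ∸ j) j)) (i+[j∸i]+[k∸j]≡k (<⇒≤ j<k) (<⇒≤ k<n))) ,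
     λ x _ → trans (cong (λ c → bt 0 j c x) n∸j≡[k∸j]+[n∸k]) (sym (bt[0,a,c]∘bt[c,a,e]≗bt[0,a,c+e] j (k ∸ j) (n ∸ k) x)))
  where
  n∸j≡[k∸j]+[n∸k] : n ∸ j ≡ (k ∸ j) + (n ∸ k)
  n∸j≡[k∸j]+[n∸k] = trans (cong (_∸ j) (sym (m+[n∸m]≡n (<⇒≤ k<n)))) (+-∸-comm (n ∸ k) (<⇒≤ j<k))

F-adj-B : ∀ {n i j} → 0 < i → i < j → j < n → Adj (σ n i j n) (σ n 0 j n)
F-adj-B {n} {i} {j} 0<i i<j j<n =
  Adjℕ⇒Adj (F-Represents i<j j<n) (B-Represents (<-trans 0<i i<j) j<n)
    (0 , i , n ∸ j , 0<i , m<n⇒0<n∸m j<n ,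
     ≤-trans (+-monoˡ-≤ (n ∸ j) (<⇒≤ i<j)) (≤-reflexive (m+[n∸m]≡n (<⇒≤ j<n))) ,
     λ x _ → trans (cong (λ a → bt 0 a (n ∸ j) x) (sym (m+[n∸m]≡n (<⇒≤ i<j))))
                   (sym (bt[i,a,c]∘bt[0,i,c]≗bt[0,i+a,c] i (j ∸ i) (n ∸ j) x)))

L-adj-F : ∀ {n j k} → 0 < j → j < k → k < n → Adj (σ n 0 j k) (σ n j k n)
L-adj-F {n} {j} {k} 0<j j<k k<n =
  Adjℕ⇒Adj (L-Represents 0<j j<k k<n) (F-Represents j<k k<n)
    (0 , k ∸ j , j + (n ∸ k) , m<n⇒0<n∸m j<k , ≤-trans 0<j (m≤m+n j (n ∸ k)) ,
     ≤-reflexive (trans (x∙yz≈yx∙z (k ∸ j) j (n ∸ k)) (i+[j∸i]+[k∸j]≡k (<⇒≤ j<k) (<⇒≤ k<n))) ,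
     λ x _ → sym (bt[0,a,c]∘bt[0,c,a+e]≗bt[a,c,e] j (k ∸ j) (n ∸ k) x))

L-adj-B-unique : ∀ {n j k m} → 0 < j → j < k → k < n → 0 < m → m < n → Adj (σ n 0 j k) (σ n 0 m n) → j ≡ m
L-adj-B-unique 0<j j<k k<n 0<m m<n adj =
  Adjℕ-L-B-unique 0<j (m<n⇒0<n∸m j<k) 0<m (m<n⇒0<n∸m m<n) (subst (_< _) (sym (m+[n∸m]≡n (<⇒≤ j<k))) k<n)
    (m+[n∸m]≡n (<⇒≤ m<n)) (Adj⇒Adjℕ (L-Represents 0<j j<k k<n) (B-Represents 0<m m<n) adj)

F-adj-B-unique : ∀ {n i j m} → 0 < i → i < j → j < n → 0 < m → m < n → Adj (σ n i j n) (σ n 0 m n) → m ≡ j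
F-adj-B-unique 0<i i<j j<n 0<m m<n adj =
  trans (Adjℕ-F-B-unique 0<i (m<n⇒0<n∸m i<j) (m<n⇒0<n∸m j<n) 0<m (m<n⇒0<n∸m m<n)
          (i+[j∸i]+[k∸j]≡k (<⇒≤ i<j) (<⇒≤ j<n)) (m+[n∸m]≡n (<⇒≤ m<n))
          (Adj⇒Adjℕ (F-Represents i<j j<n) (B-Represents 0<m m<n) adj))
        (m+[n∸m]≡n (<⇒≤ i<j))

L-adj-F-unique : ∀ {n j k i j′} → 0 < j → j < k → k < n → 0 < i → i < j′ → j′ < n →
  Adj (σ n 0 j k) (σ n i j′ n) → j ≡ i × k ≡ j′
L-adj-F-unique {j = j} {k} {i} {j′} 0<j j<k k<n 0<i i<j′ j′<n adj
  with j≡i , k∸j≡j′∸i ← Adjℕ-L-F-unique 0<j (m<n⇒0<n∸m j<k) 0<i (m<n⇒0<n∸m i<j′) (m<n⇒0<n∸m j′<n)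
         (subst (_< _) (sym (m+[n∸m]≡n (<⇒≤ j<k))) k<n) (i+[j∸i]+[k∸j]≡k (<⇒≤ i<j′) (<⇒≤ j′<n))
         (Adj⇒Adjℕ (L-Represents 0<j j<k k<n) (F-Represents i<j′ j′<n) adj) =
  j≡i , (begin
    k              ≡⟨ m+[n∸m]≡n (<⇒≤ j<k) ⟨
    j + (k ∸ j)    ≡⟨ cong₂ _+_ j≡i k∸j≡j′∸i ⟩
    i + (j′ ∸ i)   ≡⟨ m+[n∸m]≡n (<⇒≤ i<j′) ⟩
    j′             ∎)
  where open ≡-Reasoning

exactly-one : ∀ {A : Set} {P : A → Set} y → P y → (∀ x → P x → x ≡ y) → HasExactly 1 P
exactly-one y Py unique =
  y ∷ [] , refl , [] ∷ [] , λ x → (λ { (here refl) → Py ; (there ()) }) , λ Px → here (unique x Px)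

B-neighbour-of-L∪F : ∀ {n} (π : Word (suc n)) → Lset (suc n) π ⊎ Fset (suc n) π →
  HasExactly 1 (λ ρ → Bset (suc n) ρ × Adj π ρ)
B-neighbour-of-L∪F _ (inj₁ (j , k , 0<j , j<k , k≤n , refl)) =
  exactly-one (σ _ 0 j _) ((j , 0<j , ≤-trans (<⇒≤ j<k) k≤n , refl) , L-adj-B 0<j j<k (s≤s k≤n))
    λ { _ ((m , 0<m , m≤n , refl) , adj) →
          cong (λ m → σ _ 0 m _) (sym (L-adj-B-unique 0<j j<k (s≤s k≤n) 0<m (s≤s m≤n) adj)) }
B-neighbour-of-L∪F _ (inj₂ (i , j , 0<i , i<j , j<n , refl)) =
  exactly-one (σ _ 0 j _) ((j , <-trans 0<i i<j , ≤-pred j<n , refl) , F-adj-B 0<i i<j j<n)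
    λ { _ ((m , 0<m , m≤n , refl) , adj) →
          cong (λ m → σ _ 0 m _) (F-adj-B-unique 0<i i<j j<n 0<m (s≤s m≤n) adj) }

F-neighbour-of-L : ∀ {n} (π : Word (suc n)) → Lset (suc n) π → HasExactly 1 (λ ρ → Fset (suc n) ρ × Adj π ρ)
F-neighbour-of-L _ (j , k , 0<j , j<k , k≤n , refl) =
  exactly-one (σ _ j k _) ((j , k , 0<j , j<k , s≤s k≤n , refl) , L-adj-F 0<j j<k (s≤s k≤n))
    λ { _ ((i , j′ , 0<i , i<j′ , j′<n , refl) , adj) →
          let j≡i , k≡j′ = L-adj-F-unique 0<j j<k (s≤s k≤n) 0<i i<j′ j′<n adj
          in cong₂ (λ i j → σ _ i j _) (sym j≡i) (sym k≡j′) }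

L-neighbour-of-F : ∀ {n} (π : Word (suc n)) → Fset (suc n) π → HasExactly 1 (λ ρ → Lset (suc n) ρ × Adj π ρ)
L-neighbour-of-F _ (i , j , 0<i , i<j , j<n , refl) =
  exactly-one (σ _ 0 i j) ((i , j , 0<i , i<j , ≤-pred j<n , refl) ,
                           Adj-sym (L-Represents 0<i i<j j<n) (F-Represents i<j j<n) (L-adj-F 0<i i<j j<n))
    λ { _ ((j′ , k′ , 0<j′ , j′<k′ , k′≤n , refl) , adj) →
          let j′≡i , k′≡j = L-adj-F-unique 0<j′ j′<k′ (s≤s k′≤n) 0<i i<j j<n
                              (Adj-sym (F-Represents i<j j<n) (L-Represents 0<j′ j′<k′ (s≤s k′≤n)) adj)
          in cong₂ (σ _ 0) j′≡i k′≡j }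

-- The neighbours of σ(0, m, n) in L ∪ F

-- Vertices of L and F are recovered from their unique neighbour on the other side.
σ-L-injective : ∀ {n j k k′} → 0 < j → j < k → k < n → j < k′ → k′ < n → σ n 0 j k ≡ σ n 0 j k′ → k ≡ k′
σ-L-injective {n} {j} {k} 0<j j<k k<n j<k′ k′<n L≡L′ =
  sym (proj₂ (L-adj-F-unique 0<j j<k′ k′<n 0<j j<k k<n (subst (λ w → Adj w (σ n j k n)) L≡L′ (L-adj-F 0<j j<k k<n))))

σ-F-injective : ∀ {n i i′ j} → 0 < i → i < j → 0 < i′ → i′ < j → j < n → σ n i j n ≡ σ n i′ j n → i ≡ i′
σ-F-injective {n} {i} {j = j} 0<i i<j 0<i′ i′<j j<n F≡F′ =
  proj₁ (L-adj-F-unique 0<i i<j j<n 0<i′ i′<j j<n (subst (Adj (σ n 0 i j)) F≡F′ (L-adj-F 0<i i<j j<n)))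

L≢F : ∀ {n j k i j′} → 0 < j → j < k → k < n → 0 < i → i < j′ → j′ < n → σ n 0 j k ≢ σ n i j′ n
L≢F {n} {j} {k} {i} {j′} 0<j j<k k<n 0<i i<j′ j′<n L≡F = <⇒≢ 0<j (sym (begin
  j                           ≡⟨ bt-front₀ {0} {j} {k ∸ j} (m<n⇒0<n∸m j<k) ⟨
  bt 0 j (k ∸ j) 0            ≡⟨ Represents-agree (L-Represents 0<j j<k k<n) F-Represents′ 0<n ⟩
  bt i (j′ ∸ i) (n ∸ j′) 0    ≡⟨ bt-before 0<i ⟩
  0                           ∎))
  where
  open ≡-Reasoning
  F-Represents′ : σ n 0 j k Represents bt i (j′ ∸ i) (n ∸ j′)
  F-Represents′ = subst (_Represents bt i (j′ ∸ i) (n ∸ j′)) (sym L≡F) (F-Represents i<j′ j′<n)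
  0<n : 0 < n
  0<n = <-trans 0<i (<-trans i<j′ j′<n)

module NeighboursOfB {n m : ℕ} (m≤n : m ≤ n) where

  N : ℕ
  N = suc (suc n)

  M : ℕ
  M = suc m

  0<M : 0 < M
  0<M = z<s

  M<N : M < N
  M<N = s≤s (s≤s m≤n)

  L : ℕ → Word N
  L t = σ N 0 M (suc M + t)

  F : ℕ → Word N
  F t = σ N (suc t) M N

  Ls : List (Word N)
  Ls = applyDownFrom L (n ∸ m)

  Fs : List (Word N)
  Fs = applyDownFrom F m

  M<L-end : ∀ t → M < suc M + t
  M<L-end t = m≤m+n (suc M) t

  L-end<N : ∀ {t} → t < n ∸ m → suc M + t < N
  L-end<N t<n∸m = s≤s (s≤s (subst (m + _ <_) (m+[n∸m]≡n m≤n) (+-monoʳ-< m t<n∸m)))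

  L-index : ∀ {k} → M < k → k < N → k ∸ suc M < n ∸ m
  L-index M<k k<N =
    +-cancelˡ-< (suc M) _ _ (subst₂ _<_ (sym (m+[n∸m]≡n M<k)) (cong (suc ∘ suc) (sym (m+[n∸m]≡n m≤n))) k<N)

  length-Ls++Fs : length (Ls ++ Fs) ≡ N ∸ 2
  length-Ls++Fs =
    trans (length-++ Ls) (trans (cong₂ _+_ (length-applyDownFrom L (n ∸ m)) (length-applyDownFrom F m)) (m∸n+n≡m m≤n))

  unique-Ls++Fs : Unique (Ls ++ Fs)
  unique-Ls++Fs = ++⁺ (applyDownFrom⁺₁ L (n ∸ m) L-distinct) (applyDownFrom⁺₁ F m F-distinct) Ls∩Fs≡∅
    where
    L-distinct : ∀ {t t′} → t′ < t → t < n ∸ m → L t ≢ L t′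
    L-distinct {t} {t′} t′<t t<n∸m Lt≡Lt′ = <⇒≢ t′<t (sym (+-cancelˡ-≡ (suc M) t t′
      (σ-L-injective 0<M (M<L-end t) (L-end<N t<n∸m) (M<L-end t′) (L-end<N (<-trans t′<t t<n∸m)) Lt≡Lt′)))
    F-distinct : ∀ {t t′} → t′ < t → t < m → F t ≢ F t′
    F-distinct t′<t t<m Ft≡Ft′ =
      <⇒≢ t′<t (sym (suc-injective (σ-F-injective z<s (s≤s t<m) z<s (s≤s (<-trans t′<t t<m)) M<N Ft≡Ft′)))
    Ls∩Fs≡∅ : ∀ {ρ} → ¬ (ρ ∈ Ls × ρ ∈ Fs)
    Ls∩Fs≡∅ (ρ∈Ls , ρ∈Fs) with t , t<n∸m , refl ← ∈-applyDownFrom⁻ L ρ∈Ls | t′ , t′<m , Lt≡Ft′ ← ∈-applyDownFrom⁻ F ρ∈Fs =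
      L≢F 0<M (M<L-end t) (L-end<N t<n∸m) z<s (s≤s t′<m) M<N Lt≡Ft′

  Ls++Fs-sound : ∀ ρ → ρ ∈ Ls ++ Fs → (Lset N ρ ⊎ Fset N ρ) × Adj (σ N 0 M N) ρ
  Ls++Fs-sound ρ ρ∈ with ∈-++⁻ Ls ρ∈
  ... | inj₁ ρ∈Ls with t , t<n∸m , refl ← ∈-applyDownFrom⁻ L ρ∈Ls =
    inj₁ (M , suc M + t , 0<M , M<L-end t , ≤-pred (L-end<N t<n∸m) , refl) ,
    Adj-sym (L-Represents 0<M (M<L-end t) (L-end<N t<n∸m)) (B-Represents 0<M M<N) (L-adj-B 0<M (M<L-end t) (L-end<N t<n∸m))
  ... | inj₂ ρ∈Fs with t , t<m , refl ← ∈-applyDownFrom⁻ F ρ∈Fs =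
    inj₂ (suc t , M , z<s , s≤s t<m , M<N , refl) ,
    Adj-sym (F-Represents (s≤s t<m) M<N) (B-Represents 0<M M<N) (F-adj-B z<s (s≤s t<m) M<N)

  Ls++Fs-complete : ∀ ρ → (Lset N ρ ⊎ Fset N ρ) × Adj (σ N 0 M N) ρ → ρ ∈ Ls ++ Fs
  Ls++Fs-complete _ (inj₁ (j , k , 0<j , j<k , k≤N-1 , refl) , adj) =
    ∈-++⁺ˡ (subst (_∈ Ls) (cong₂ (σ N 0) (sym j≡M) (m+[n∸m]≡n M<k)) (∈-applyDownFrom⁺ L (L-index M<k (s≤s k≤N-1))))
    where
    j≡M : j ≡ M
    j≡M = L-adj-B-unique 0<j j<k (s≤s k≤N-1) 0<M M<N
            (Adj-sym (B-Represents 0<M M<N) (L-Represents 0<j j<k (s≤s k≤N-1)) adj)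
    M<k : M < k
    M<k = subst (_< k) j≡M j<k
  Ls++Fs-complete _ (inj₂ (suc t , j , z<s , 1+t<j , j<N , refl) , adj) =
    ∈-++⁺ʳ Ls (subst (_∈ Fs) (cong (λ j → σ N (suc t) j N) M≡j) (∈-applyDownFrom⁺ F (≤-pred (subst (suc t <_) (sym M≡j) 1+t<j))))
    where
    M≡j : M ≡ j
    M≡j = F-adj-B-unique z<s 1+t<j j<N 0<M M<N (Adj-sym (B-Represents 0<M M<N) (F-Represents 1+t<j j<N) adj)

L∪F-neighbours-of-B : ∀ {n} (π : Word (suc n)) → Bset (suc n) π →
  HasExactly (suc n ∸ 2) (λ ρ → (Lset (suc n) ρ ⊎ Fset (suc n) ρ) × Adj π ρ)
L∪F-neighbours-of-B {zero} _ (suc _ , _ , () , _)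
L∪F-neighbours-of-B {suc n} _ (suc m , z<s , s≤s m≤n , refl) =
  Ls ++ Fs , length-Ls++Fs , unique-Ls++Fs , λ ρ → Ls++Fs-sound ρ , Ls++Fs-complete ρ
  where open NeighboursOfB m≤n

proposition3 : (n : ℕ) → 1 ≤ n →
    ((π : Word n) → (Lset n π ⊎ Fset n π) → HasExactly 1 (λ ρ → Bset n ρ × Adj π ρ))
    × ((π : Word n) → Bset n π → HasExactly (n ∸ 2) (λ ρ → (Lset n ρ ⊎ Fset n ρ) × Adj π ρ))
    × ((π : Word n) → Lset n π → HasExactly 1 (λ ρ → Fset n ρ × Adj π ρ))
    × ((π : Word n) → Fset n π → HasExactly 1 (λ ρ → Lset n ρ × Adj π ρ))
proposition3 (suc n) _ = B-neighbour-of-L∪F , L∪F-neighbours-of-B , F-neighbour-of-L , L-neighbour-of-F
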